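{- Let $\Sigma$ be a finite alphabet, and let $A = a_1 \ldots a_n$ and $B = b_1 \ldots b_m$ be strings over $\Sigma$ with $n \ge m$. Consider the modified edit graph of $A$ and $B$. Then the minimum cost of a path from $d_{00}$ to $d_{mn}$ in the modified edit graph, plus $n-m$, equals the Levenshtein edit distance of $A$ and $B$.
   Context: Levenshtein edit distance is the minimum number of single-character insertions, deletions and substitutions transforming $A$ into $B$. The cells are $d_{ij}$ for $0 \le i \le m$ and $0 \le j \le n$. Cell $d_{ij}$ lies on diagonal $j-i$, and diagonal $n-m$ is called the main diagonal. The transitions are the following. - Horizontal: $d_{ij} \to d_{i,j+1}$. - Vertical: $d_{ij} \to d_{i+1,j}$. - Diagonal: $d_{ij} \to d_{i+1,j+1}$. In the modified edit graph the costs are assigned as follows. - A diagonal transition $d_{ij}\to d_{i+1,j+1}$ costs $0$ if $a_{j+1} = b_{i+1}$ and $1$ otherwise. - In the part of the graph left of the main diagonal (cells on diagonals $\le n-m$), a vertical transition costs $2$ and a horizontal transition costs $0$. - Symmetrically, in the part right of the main diagonal (cells on diagonals $\ge n-m$), a horizontal transition costs $2$ and a vertical transition costs $0$. Equivalently, an indel transition that moves away from the main diagonal costs $2$, and one that moves toward it costs $0$. -}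

module Defs where

open import Data.Nat using (ℕ; zero; suc; _+_; _≤_; _<_)
open import Data.Fin using (Fin; fromℕ<)
open import Data.Fin.Properties using (_≟_)
open import Data.Vec using (Vec; lookup)
open import Data.List using (List; []; _∷_; _++_)
open import Data.Product using (_×_)
open import Relation.Nullary using (yes; no)
open import Data.Nat using (_≤?_)

module _ {s : ℕ} where

  data EditStep : List (Fin s) → List (Fin s) → Set where
    insertion    : (xs ys : List (Fin s)) (c : Fin s) →
                   EditStep (xs ++ ys) (xs ++ c ∷ ys)
    deletion     : (xs ys : List (Fin s)) (c : Fin s) →
                   EditStep (xs ++ c ∷ ys) (xs ++ ys)
    substitution : (xs ys : List (Fin s)) (c d : Fin s) →
                   EditStep (xs ++ c ∷ ys) (xs ++ d ∷ ys)

  data EditSeq : ℕ → List (Fin s) → List (Fin s) → Set where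
    none : (X : List (Fin s)) → EditSeq 0 X X
    more : {k : ℕ} {X Y Z : List (Fin s)} →
           EditStep X Y → EditSeq k Y Z → EditSeq (suc k) X Z

  IsEditDistance : List (Fin s) → List (Fin s) → ℕ → Set
  IsEditDistance X Y k = EditSeq k X Y × (∀ k' → EditSeq k' X Y → k ≤ k')

-- Cell d_{ij} (0 ≤ i ≤ m, 0 ≤ j ≤ n) lies on diagonal j - i; the main
-- diagonal is n - m.  Comparisons "diagonal ≤ n - m" are written without
-- subtraction: j - i ≤ n - m  ⇔  j + m ≤ n + i.

module ModifiedEditGraph {s n m : ℕ} (A : Vec (Fin s) n) (B : Vec (Fin s) m) where

  diagCost : (i j : ℕ) → i < m → j < n → ℕ
  diagCost i j i<m j<n with lookup A (fromℕ< j<n) ≟ lookup B (fromℕ< i<m)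
  ... | yes _ = 0
  ... | no  _ = 1

  vertCost : (i j : ℕ) → ℕ
  vertCost i j with (j + m) ≤? (n + i)
  ... | yes _ = 2
  ... | no  _ = 0

  horCost : (i j : ℕ) → ℕ
  horCost i j with (n + i) ≤? (j + m)
  ... | yes _ = 2
  ... | no  _ = 0

  data PathTo : ℕ → ℕ → ℕ → Set where
    arrive : PathTo m n 0
    horiz  : {i j c : ℕ} → i ≤ m → j < n →
             PathTo i (suc j) c → PathTo i j (horCost i j + c)
    vert   : {i j c : ℕ} → i < m → j ≤ n →
             PathTo (suc i) j c → PathTo i j (vertCost i j + c)
    diag   : {i j c : ℕ} (i<m : i < m) (j<n : j < n) →
             PathTo (suc i) (suc j) c → PathTo i j (diagCost i j i<m j<n + c)

  IsMinPathCost : ℕ → Set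
  IsMinPathCost c = PathTo 0 0 c × (∀ c' → PathTo 0 0 c' → c ≤ c')

-- Give every cell d_ij the potential |(j − i) − (n − m)|, the distance of its diagonal from
-- the main one. The modified cost of an indel step is 1 plus the increase of the potential
-- along it, and a diagonal step keeps the potential. Telescoping, a path from d_ij to d_mn of
-- modified cost c is an alignment of a_{j+1}…a_n with b_{i+1}…b_m of ordinary cost
-- c + potential(i, j), and conversely. At d_00 the potential is n − m, and minimal alignments
-- have Levenshtein cost.
module Submission where

open import Defs
open import Data.Nat using (ℕ; zero; suc; _+_; _∸_; _⊓_; _≤_; _<_; z≤n; s≤s; _≤?_; ∣_-_∣)
open import Data.Nat.Properties hiding (_≟_)
open import Data.Fin using (Fin; fromℕ<)
open import Data.Fin.Properties using (_≟_)
open import Data.Vec using (Vec; toList; lookup)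
import Data.Vec as Vec
open import Data.List using (List; []; _∷_; _++_; drop)
open import Data.List.Properties using (∷-injective)
open import Data.Product using (Σ; ∃; _×_; _,_; proj₁)
open import Data.Sum using (inj₁; inj₂)
open import Relation.Binary.PropositionalEquality
open import Relation.Nullary using (yes; no; contradiction)

m≤n⇒∣m-1+n∣≡1+∣m-n∣ : ∀ {m n} → m ≤ n → ∣ m - suc n ∣ ≡ suc ∣ m - n ∣
m≤n⇒∣m-1+n∣≡1+∣m-n∣ {zero}  _         = refl
m≤n⇒∣m-1+n∣≡1+∣m-n∣ {suc m} (s≤s m≤n) = m≤n⇒∣m-1+n∣≡1+∣m-n∣ m≤n

n≤m⇒∣1+m-n∣≡1+∣m-n∣ : ∀ {m n} → n ≤ m → ∣ suc m - n ∣ ≡ suc ∣ m - n ∣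
n≤m⇒∣1+m-n∣≡1+∣m-n∣ {m}     {zero}  _         = cong suc (sym (∣-∣-identityʳ m))
n≤m⇒∣1+m-n∣≡1+∣m-n∣ {suc m} {suc n} (s≤s n≤m) = n≤m⇒∣1+m-n∣≡1+∣m-n∣ n≤m

n<m⇒∣m-n∣≡1+∣m-1+n∣ : ∀ {m n} → n < m → ∣ m - n ∣ ≡ suc ∣ m - suc n ∣
n<m⇒∣m-n∣≡1+∣m-1+n∣ {suc m} {zero}  _         = cong suc (sym (∣-∣-identityʳ m))
n<m⇒∣m-n∣≡1+∣m-1+n∣ {suc m} {suc n} (s≤s n<m) = n<m⇒∣m-n∣≡1+∣m-1+n∣ n<m

m<n⇒∣m-n∣≡1+∣1+m-n∣ : ∀ {m n} → m < n → ∣ m - n ∣ ≡ suc ∣ suc m - n ∣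
m<n⇒∣m-n∣≡1+∣1+m-n∣ {zero}  {suc n} _         = refl
m<n⇒∣m-n∣≡1+∣1+m-n∣ {suc m} {suc n} (s≤s m<n) = m<n⇒∣m-n∣≡1+∣1+m-n∣ m<n

⊓-pres : ∀ {ℓ} (P : ℕ → Set ℓ) {a b : ℕ} → P a → P b → P (a ⊓ b)
⊓-pres P {a} {b} pa pb with ⊓-sel a b
... | inj₁ a⊓b≡a = subst P (sym a⊓b≡a) pa
... | inj₂ a⊓b≡b = subst P (sym a⊓b≡b) pb

telescope-step : ∀ h c {p p'} → h + p ≡ suc p' → h + c + p ≡ suc (c + p')
telescope-step h c {p} {p'} e = begin
  h + c + p    ≡⟨ +-assoc h c p ⟩
  h + (c + p)  ≡⟨ cong (h +_) (+-comm c p) ⟩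
  h + (p + c)  ≡⟨ sym (+-assoc h p c) ⟩
  h + p + c    ≡⟨ cong (_+ c) e ⟩
  suc (p' + c) ≡⟨ cong suc (+-comm p' c) ⟩
  suc (c + p') ∎
  where open ≡-Reasoning

module _ {a} {X : Set a} where

  suffix : ∀ {k} → Vec X k → ℕ → List X
  suffix W j = drop j (toList W)

  suffix-full : ∀ {k} (W : Vec X k) → suffix W k ≡ []
  suffix-full Vec.[]      = refl
  suffix-full (w Vec.∷ W) = suffix-full W

  suffix-lookup : ∀ {k j} (W : Vec X k) (j<k : j < k) →
                  suffix W j ≡ lookup W (fromℕ< j<k) ∷ suffix W (suc j)
  suffix-lookup {j = zero}  (w Vec.∷ W) (s≤s _)   = refl
  suffix-lookup {j = suc j} (w Vec.∷ W) (s≤s j<k) = suffix-lookup W j<k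

  suffix≡[]⇒≡ : ∀ {k j} (W : Vec X k) → j ≤ k → suffix W j ≡ [] → j ≡ k
  suffix≡[]⇒≡ {j = zero}  Vec.[]      _         _ = refl
  suffix≡[]⇒≡ {j = zero}  (w Vec.∷ W) _         ()
  suffix≡[]⇒≡ {j = suc j} (w Vec.∷ W) (s≤s j≤k) e = cong suc (suffix≡[]⇒≡ W j≤k e)

  suffix≡∷⇒< : ∀ {k j x xs} (W : Vec X k) → suffix W j ≡ x ∷ xs → j < k
  suffix≡∷⇒< {j = zero}  (w Vec.∷ W) _ = s≤s z≤n
  suffix≡∷⇒< {j = suc j} (w Vec.∷ W) e = s≤s (suffix≡∷⇒< W e)

  suffix-uncons : ∀ {k j x xs} (W : Vec X k) → suffix W j ≡ x ∷ xs →
                  Σ (j < k) λ j<k → lookup W (fromℕ< j<k) ≡ x × suffix W (suc j) ≡ xs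
  suffix-uncons W e = j<k , ∷-injective (trans (sym (suffix-lookup W j<k)) e)
    where j<k = suffix≡∷⇒< W e

module _ {s : ℕ} where

  mismatch : Fin s → Fin s → ℕ
  mismatch x y with x ≟ y
  ... | yes _ = 0
  ... | no  _ = 1

  mismatch-refl : ∀ x → mismatch x x ≡ 0
  mismatch-refl x with x ≟ x
  ... | yes _  = refl
  ... | no x≢x = contradiction refl x≢x

  mismatch≤1 : ∀ x y → mismatch x y ≤ 1
  mismatch≤1 x y with x ≟ y
  ... | yes _ = z≤n
  ... | no  _ = s≤s z≤n

  data Alignment : List (Fin s) → List (Fin s) → ℕ → Set where
    nil : Alignment [] [] 0
    del : ∀ {xs ys c} x → Alignment xs ys c → Alignment (x ∷ xs) ys (suc c)
    ins : ∀ {xs ys c} y → Alignment xs ys c → Alignment xs (y ∷ ys) (suc c)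
    sub : ∀ {xs ys c} x y → Alignment xs ys c → Alignment (x ∷ xs) (y ∷ ys) (mismatch x y + c)

  Alignment-refl : ∀ xs → Alignment xs xs 0
  Alignment-refl []       = nil
  Alignment-refl (x ∷ xs) = subst (Alignment (x ∷ xs) (x ∷ xs)) (cong (_+ 0) (mismatch-refl x))
                                  (sub x x (Alignment-refl xs))

  ∷-editStep : ∀ {X Y : List (Fin s)} x → EditStep X Y → EditStep (x ∷ X) (x ∷ Y)
  ∷-editStep x (insertion xs ys c)      = insertion (x ∷ xs) ys c
  ∷-editStep x (deletion xs ys c)       = deletion (x ∷ xs) ys c
  ∷-editStep x (substitution xs ys c d) = substitution (x ∷ xs) ys c d

  ∷-editSeq : ∀ {k} {X Y : List (Fin s)} x → EditSeq k X Y → EditSeq k (x ∷ X) (x ∷ Y)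
  ∷-editSeq x (none X)     = none (x ∷ X)
  ∷-editSeq x (more st sq) = more (∷-editStep x st) (∷-editSeq x sq)

  alignment⇒editSeq : ∀ {X Y c} → Alignment X Y c → EditSeq c X Y
  alignment⇒editSeq nil         = none []
  alignment⇒editSeq (del x al)  = more (deletion [] _ x) (alignment⇒editSeq al)
  alignment⇒editSeq (ins y al)  = more (insertion [] _ y) (∷-editSeq y (alignment⇒editSeq al))
  alignment⇒editSeq (sub x y al) with x ≟ y
  ... | yes refl = ∷-editSeq x (alignment⇒editSeq al)
  ... | no  _    = more (substitution [] _ x y) (∷-editSeq y (alignment⇒editSeq al))

  Alignment≤ : List (Fin s) → List (Fin s) → ℕ → Set
  Alignment≤ X Y b = ∃ λ c → c ≤ b × Alignment X Y c

  exact : ∀ {X Y c} → Alignment X Y c → Alignment≤ X Y c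
  exact al = _ , ≤-refl , al

  weaken : ∀ {X Y b b'} → b ≤ b' → Alignment≤ X Y b → Alignment≤ X Y b'
  weaken b≤b' (c , c≤b , al) = c , ≤-trans c≤b b≤b' , al

  del≤ : ∀ {X Y b} x → Alignment≤ X Y b → Alignment≤ (x ∷ X) Y (suc b)
  del≤ x (c , c≤b , al) = suc c , s≤s c≤b , del x al

  ins≤ : ∀ {X Y b} y → Alignment≤ X Y b → Alignment≤ X (y ∷ Y) (suc b)
  ins≤ y (c , c≤b , al) = suc c , s≤s c≤b , ins y al

  sub≤ : ∀ {X Y b} x y → Alignment≤ X Y (suc b) → Alignment≤ (x ∷ X) (y ∷ Y) (suc (mismatch x y + b))
  sub≤ x y (c , c≤b , al) =
    _ , subst (mismatch x y + c ≤_) (+-suc (mismatch x y) _) (+-monoʳ-≤ (mismatch x y) c≤b)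
      , sub x y al

  Alignment≤-deletion : ∀ {Z c} p q x → Alignment (p ++ q) Z c → Alignment≤ (p ++ x ∷ q) Z (suc c)
  Alignment≤-deletion []      q x al          = exact (del x al)
  Alignment≤-deletion (a ∷ p) q x (del _ al)  = del≤ a (Alignment≤-deletion p q x al)
  Alignment≤-deletion (a ∷ p) q x (ins z al)  = ins≤ z (Alignment≤-deletion (a ∷ p) q x al)
  Alignment≤-deletion (a ∷ p) q x (sub _ z al) = sub≤ a z (Alignment≤-deletion p q x al)

  Alignment≤-insertion : ∀ {Z c} p q x → Alignment (p ++ x ∷ q) Z c → Alignment≤ (p ++ q) Z (suc c)
  Alignment≤-insertion []      q x (del _ al)   = weaken (m≤n+m _ 2) (exact al)
  Alignment≤-insertion []      q x (ins z al)   = ins≤ z (Alignment≤-insertion [] q x al)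
  Alignment≤-insertion []      q x (sub _ z al) = weaken (s≤s (m≤n+m _ (mismatch x z))) (exact (ins z al))
  Alignment≤-insertion (a ∷ p) q x (del _ al)   = del≤ a (Alignment≤-insertion p q x al)
  Alignment≤-insertion (a ∷ p) q x (ins z al)   = ins≤ z (Alignment≤-insertion (a ∷ p) q x al)
  Alignment≤-insertion (a ∷ p) q x (sub _ z al) = sub≤ a z (Alignment≤-insertion p q x al)

  Alignment≤-substitution : ∀ {Z c} p q x y → Alignment (p ++ y ∷ q) Z c →
                            Alignment≤ (p ++ x ∷ q) Z (suc c)
  Alignment≤-substitution []      q x y (del _ al)   = weaken (n≤1+n _) (exact (del x al))
  Alignment≤-substitution []      q x y (ins z al)   = ins≤ z (Alignment≤-substitution [] q x y al)
  Alignment≤-substitution []      q x y (sub _ z al) =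
    weaken (+-mono-≤ (mismatch≤1 x z) (m≤n+m _ (mismatch y z))) (exact (sub x z al))
  Alignment≤-substitution (a ∷ p) q x y (del _ al)   = del≤ a (Alignment≤-substitution p q x y al)
  Alignment≤-substitution (a ∷ p) q x y (ins z al)   = ins≤ z (Alignment≤-substitution (a ∷ p) q x y al)
  Alignment≤-substitution (a ∷ p) q x y (sub _ z al) = sub≤ a z (Alignment≤-substitution p q x y al)

  Alignment≤-editStep : ∀ {X Y Z c} → EditStep X Y → Alignment Y Z c → Alignment≤ X Z (suc c)
  Alignment≤-editStep (insertion xs ys x)      = Alignment≤-insertion xs ys x
  Alignment≤-editStep (deletion xs ys x)       = Alignment≤-deletion xs ys x
  Alignment≤-editStep (substitution xs ys x y) = Alignment≤-substitution xs ys x y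

  editSeq⇒alignment : ∀ {k X Y} → EditSeq k X Y → Alignment≤ X Y k
  editSeq⇒alignment (none X)      = exact (Alignment-refl X)
  editSeq⇒alignment (more st sq) with editSeq⇒alignment sq
  ... | _ , c≤k , al = weaken (s≤s c≤k) (Alignment≤-editStep st al)

  levenshtein : List (Fin s) → List (Fin s) → ℕ
  levenshtein []       []       = 0
  levenshtein []       (y ∷ ys) = suc (levenshtein [] ys)
  levenshtein (x ∷ xs) []       = suc (levenshtein xs [])
  levenshtein (x ∷ xs) (y ∷ ys) =
    suc (levenshtein xs (y ∷ ys)) ⊓ suc (levenshtein (x ∷ xs) ys) ⊓ (mismatch x y + levenshtein xs ys)

  levenshtein-alignment : ∀ X Y → Alignment X Y (levenshtein X Y)
  levenshtein-alignment []       []       = nil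
  levenshtein-alignment []       (y ∷ ys) = ins y (levenshtein-alignment [] ys)
  levenshtein-alignment (x ∷ xs) []       = del x (levenshtein-alignment xs [])
  levenshtein-alignment (x ∷ xs) (y ∷ ys) =
    ⊓-pres P (⊓-pres P (del x (levenshtein-alignment xs (y ∷ ys)))
                       (ins y (levenshtein-alignment (x ∷ xs) ys)))
             (sub x y (levenshtein-alignment xs ys))
    where P = Alignment (x ∷ xs) (y ∷ ys)

  levenshtein-minimal : ∀ {X Y c} → Alignment X Y c → levenshtein X Y ≤ c
  levenshtein-minimal nil = z≤n
  levenshtein-minimal (del {ys = []} x al) = s≤s (levenshtein-minimal al)
  levenshtein-minimal (del {ys = y ∷ ys} x al) =
    m≤n⇒m⊓o≤n _ (m≤n⇒m⊓o≤n _ (s≤s (levenshtein-minimal al)))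
  levenshtein-minimal (ins {xs = []} y al) = s≤s (levenshtein-minimal al)
  levenshtein-minimal (ins {xs = x ∷ xs} y al) =
    m≤n⇒m⊓o≤n _ (m≤n⇒o⊓m≤n _ (s≤s (levenshtein-minimal al)))
  levenshtein-minimal (sub x y al) = m≤n⇒o⊓m≤n _ (+-monoʳ-≤ (mismatch x y) (levenshtein-minimal al))

  levenshtein-isEditDistance : ∀ X Y → IsEditDistance X Y (levenshtein X Y)
  levenshtein-isEditDistance X Y = alignment⇒editSeq (levenshtein-alignment X Y) , minimal
    where
    minimal : ∀ k → EditSeq k X Y → levenshtein X Y ≤ k
    minimal k sq with editSeq⇒alignment sq
    ... | _ , c≤k , al = ≤-trans (levenshtein-minimal al) c≤k

module _ {s n m : ℕ} (A : Vec (Fin s) n) (B : Vec (Fin s) m) where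
  open ModifiedEditGraph A B

  potential : ℕ → ℕ → ℕ
  potential i j = ∣ n + i - j + m ∣

  potential-origin : m ≤ n → potential 0 0 ≡ n ∸ m
  potential-origin m≤n = trans (cong (∣_- m ∣) (+-identityʳ n)) (m≤n⇒∣n-m∣≡n∸m m≤n)

  horCost-reduced : ∀ i j → horCost i j + potential i j ≡ suc (potential i (suc j))
  horCost-reduced i j with (n + i) ≤? (j + m)
  ... | yes ≤ = cong suc (sym (m≤n⇒∣m-1+n∣≡1+∣m-n∣ ≤))
  ... | no  ≰ = n<m⇒∣m-n∣≡1+∣m-1+n∣ (≰⇒> ≰)

  vertCost-reduced : ∀ i j → vertCost i j + potential i j ≡ suc (potential (suc i) j)
  vertCost-reduced i j rewrite +-suc n i with (j + m) ≤? (n + i)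
  ... | yes ≤ = cong suc (sym (n≤m⇒∣1+m-n∣≡1+∣m-n∣ ≤))
  ... | no  ≰ = m<n⇒∣m-n∣≡1+∣1+m-n∣ (≰⇒> ≰)

  diagCost-reduced : ∀ i j (i<m : i < m) (j<n : j < n) c →
                     diagCost i j i<m j<n + c + potential i j ≡
                     mismatch (lookup A (fromℕ< j<n)) (lookup B (fromℕ< i<m))
                       + (c + potential (suc i) (suc j))
  diagCost-reduced i j i<m j<n c
    rewrite +-suc n i | +-assoc (diagCost i j i<m j<n) c (potential i j)
    with lookup A (fromℕ< j<n) ≟ lookup B (fromℕ< i<m)
  ... | yes _ = refl
  ... | no  _ = refl

  path⇒alignment : ∀ {i j c} → PathTo i j c → Alignment (suffix A j) (suffix B i) (c + potential i j)
  path⇒alignment arrive =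
    subst₂ (λ X Y → Alignment X Y (potential m n)) (sym (suffix-full A)) (sym (suffix-full B))
           (subst (Alignment [] []) (sym (∣n-n∣≡0 (n + m))) nil)
  path⇒alignment (horiz {i} {j} {c} _ j<n p) =
    subst₂ (λ X k → Alignment X (suffix B i) k) (sym (suffix-lookup A j<n))
           (sym (telescope-step (horCost i j) c (horCost-reduced i j))) (del _ (path⇒alignment p))
  path⇒alignment (vert {i} {j} {c} i<m _ p) =
    subst₂ (λ Y k → Alignment (suffix A j) Y k) (sym (suffix-lookup B i<m))
           (sym (telescope-step (vertCost i j) c (vertCost-reduced i j))) (ins _ (path⇒alignment p))
  path⇒alignment (diag {i} {j} {c} i<m j<n p) =
    subst (Alignment (suffix A j) (suffix B i)) (sym (diagCost-reduced i j i<m j<n c))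
          (subst₂ (λ X Y → Alignment X Y (mismatch a b + (c + potential (suc i) (suc j))))
                  (sym (suffix-lookup A j<n)) (sym (suffix-lookup B i<m)) (sub a b (path⇒alignment p)))
    where
    a = lookup A (fromℕ< j<n)
    b = lookup B (fromℕ< i<m)

  alignment⇒path : ∀ {X Y c'} i j → i ≤ m → j ≤ n → suffix A j ≡ X → suffix B i ≡ Y →
                   Alignment X Y c' → ∃ λ c → PathTo i j c × c + potential i j ≡ c'
  alignment⇒path i j i≤m j≤n eX eY nil
    with suffix≡[]⇒≡ A j≤n eX | suffix≡[]⇒≡ B i≤m eY
  ... | refl | refl = 0 , arrive , ∣n-n∣≡0 (n + m)
  alignment⇒path i j i≤m j≤n eX eY (del x al) with suffix-uncons A eX
  ... | j<n , _ , eX' with alignment⇒path i (suc j) i≤m j<n eX' eY al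
  ... | c , p , e =
    _ , horiz i≤m j<n p , trans (telescope-step (horCost i j) c (horCost-reduced i j)) (cong suc e)
  alignment⇒path i j i≤m j≤n eX eY (ins y al) with suffix-uncons B eY
  ... | i<m , _ , eY' with alignment⇒path (suc i) j i<m j≤n eX eY' al
  ... | c , p , e =
    _ , vert i<m j≤n p , trans (telescope-step (vertCost i j) c (vertCost-reduced i j)) (cong suc e)
  alignment⇒path i j i≤m j≤n eX eY (sub x y al) with suffix-uncons A eX | suffix-uncons B eY
  ... | j<n , ea , eX' | i<m , eb , eY' with alignment⇒path (suc i) (suc j) i<m j<n eX' eY' al
  ... | c , p , e =
    _ , diag i<m j<n p , trans (diagCost-reduced i j i<m j<n c) (cong₂ _+_ (cong₂ mismatch ea eb) e)

  shortestPath : ∃ λ c → PathTo 0 0 c × c + potential 0 0 ≡ levenshtein (toList A) (toList B)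
  shortestPath = alignment⇒path 0 0 z≤n z≤n refl refl (levenshtein-alignment (toList A) (toList B))

  levenshtein≤pathCost : ∀ {c} → PathTo 0 0 c →
                         levenshtein (toList A) (toList B) ≤ c + potential 0 0
  levenshtein≤pathCost p = levenshtein-minimal (path⇒alignment p)

  shortestPath-isMinPathCost : IsMinPathCost (proj₁ shortestPath)
  shortestPath-isMinPathCost with shortestPath
  ... | c₀ , p₀ , e₀ = p₀ , λ c p → +-cancelʳ-≤ (potential 0 0) c₀ c
                                      (subst (_≤ c + potential 0 0) (sym e₀) (levenshtein≤pathCost p))

  isMinPathCost⇒levenshtein : ∀ {c} → IsMinPathCost c →
                              c + potential 0 0 ≡ levenshtein (toList A) (toList B)
  isMinPathCost⇒levenshtein {c} (p , minimal) with shortestPath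
  ... | c₀ , p₀ , e₀ =
    ≤-antisym (subst (c + potential 0 0 ≤_) e₀ (+-monoˡ-≤ (potential 0 0) (minimal c₀ p₀)))
              (levenshtein≤pathCost p)

lemma2 : (s n m : ℕ) (A : Vec (Fin s) n) (B : Vec (Fin s) m) → m ≤ n →
    Σ ℕ (λ c → ModifiedEditGraph.IsMinPathCost A B c)
    × ((c : ℕ) → ModifiedEditGraph.IsMinPathCost A B c →
    IsEditDistance (toList A) (toList B) (c + (n ∸ m)))
lemma2 s n m A B m≤n = (_ , shortestPath-isMinPathCost A B) , isEditDistance
  where
  isEditDistance : ∀ c → ModifiedEditGraph.IsMinPathCost A B c →
                   IsEditDistance (toList A) (toList B) (c + (n ∸ m))
  isEditDistance c min = subst (IsEditDistance (toList A) (toList B))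
    (trans (sym (isMinPathCost⇒levenshtein A B min)) (cong (c +_) (potential-origin A B m≤n)))
    (levenshtein-isEditDistance (toList A) (toList B))
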